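{- Let $G=(V,E)$ be a graph. Then: (a) $h_\Delta(G)\ge\alpha(G)$; (b) if $S\subseteq V$ is Helly independent, then no three vertices of $S$ form a $K_3$ (triangle) in $G$; (c) if every pair of adjacent vertices $u,v$ of $G$ forms a hull set (i.e. $\langle\{u,v\}\rangle=V$), then $h_\Delta(G)=\max\{2,\alpha(G)\}$.
   Context: All graphs are finite, simple, undirected and connected. $\alpha(G)$ is the independence number of $G$. For $S\subseteq V$, the $\Delta$-interval $[S]$ is the set consisting of all vertices of $S$ together with every vertex $v\in V$ adjacent to both $x$ and $y$ for some pair of adjacent vertices $x,y\in S$. A set $S$ is $\Delta$-convex if $[S]=S$, and $\langle S\rangle$ denotes the smallest $\Delta$-convex set containing $S$ ($\langle\emptyset\rangle=\emptyset$). A set $S$ is Helly dependent if $\bigcap_{a\in S}\langle S\setminus\{a\}\rangle\neq\emptyset$ and Helly independent otherwise. The Helly number $h_\Delta(G)$ is the least integer $n\ge0$ such that every $S\subseteq V$ with $|S|>n$ is Helly dependent (equivalently, the maximum size of a Helly independent set). -}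

module Defs where

open import Data.Nat using (ℕ; suc; _≤_; _<_)
open import Data.Bool using (Bool; true; false)
open import Data.Fin using (Fin)
open import Data.Fin.Subset using (Subset; _∈_; _∉_; _⊆_; ∣_∣; _-_; ⁅_⁆; _∪_)
open import Data.Product using (Σ; ∃; _×_; _,_)
open import Relation.Binary.PropositionalEquality using (_≡_)
open import Relation.Nullary using (¬_)

record Graph : Set where
  field
    n      : ℕ
    adj    : Fin n → Fin n → Bool
    sym    : ∀ x y → adj x y ≡ adj y x
    irrefl : ∀ x → adj x x ≡ false

  _~_ : Fin n → Fin n → Set
  x ~ y = adj x y ≡ true

  data Reach : Fin n → Fin n → Set where
    here : ∀ {x} → Reach x x
    step : ∀ {x y z} → x ~ y → Reach y z → Reach x z

open Graph public

record ConnectedGraph : Set₁ where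
  field
    graph     : Graph
    connected : ∀ x y → Reach graph x y

open ConnectedGraph public

module _ (G : Graph) where
  private
    V = Fin (n G)
    _≈_ = _~_ G

  Independent : Subset (n G) → Set
  Independent S = ∀ x y → x ∈ S → y ∈ S → ¬ (x ≈ y)

  IsIndependenceNumber : ℕ → Set
  IsIndependenceNumber a =
    (Σ (Subset (n G)) λ S → Independent S × ∣ S ∣ ≡ a)
    × (∀ S → Independent S → ∣ S ∣ ≤ a)

  DeltaConvex : Subset (n G) → Set
  DeltaConvex S = ∀ x y v → x ∈ S → y ∈ S → x ≈ y → x ≈ v → y ≈ v → v ∈ S

  InHull : Subset (n G) → V → Set
  InHull S v = ∀ C → S ⊆ C → DeltaConvex C → v ∈ C

  HellyDependent : Subset (n G) → Set
  HellyDependent S = ∃ λ v → ∀ a → a ∈ S → InHull (S - a) v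

  HellyIndependent : Subset (n G) → Set
  HellyIndependent S = ¬ HellyDependent S

  IsHellyNumber : ℕ → Set
  IsHellyNumber h =
    (∀ S → h < ∣ S ∣ → HellyDependent S)
    × (∀ m → (∀ S → m < ∣ S ∣ → HellyDependent S) → h ≤ m)

  HullSet₂ : V → V → Set
  HullSet₂ u v = ∀ w → InHull (⁅ u ⁆ ∪ ⁅ v ⁆) w

-- Independent sets are Δ-convex, so for a nonempty independent S each ⟨S ∖ {a}⟩ is S ∖ {a},
-- and these have empty intersection; the same holds for two distinct vertices, as singletons
-- are Δ-convex. Conversely S is Helly dependent as soon as some v ∈ S lies in ⟨S ∖ {v}⟩, since
-- v ∈ S ∖ {a} for every other a: a triangle vertex is a common neighbour of the other two, and
-- when edges are hull sets, a set larger than max{2, α} contains an edge xy and a third vertex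
-- w ∈ ⟨{x, y}⟩ = V.
module Submission where

open import Defs hiding (sym)
open import Data.Nat using (ℕ; _≤_; _<_; _⊔_; _+_; z≤n; s≤s)
open import Data.Nat.Properties
  using (≤-trans; ≤-reflexive; ≤-antisym; <-≤-trans; ≮⇒≥; <⇒≱; +-suc; +-monoʳ-≤; n≤1+n; ⊔-lub; m⊔n<o⇒m<o; m⊔n<o⇒n<o)
open import Data.Bool using (true; false)
import Data.Bool.Properties as Bool
open import Data.Fin using (Fin; zero; suc; _≟_)
open import Data.Fin.Properties using (any?)
open import Data.Fin.Subset using (Subset; _∈_; _∉_; _⊆_; ∣_∣; _─_; _-_; ⁅_⁆; _∪_; Nonempty; inside; outside)
open import Data.Fin.Subset.Properties
  using (_∈?_; nonempty?; Empty-unique; ∣⊥∣≡0; p─q⊆p; x∈p∧x≢y⇒x∈p-y; x∈⁅x⁆; x∈⁅y⁆⇒x≡y;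
         x∈p∪q⁻; x∈p∪q⁺; p⊆q⇒∣p∣≤∣q∣; ∣⁅x⁆∣≡1; x∈p⇒∣p-x∣<∣p∣)
open import Data.Vec.Base using ([]; _∷_; there)
open import Data.Product using (_×_; _,_; ∃; ∃₂; proj₂)
open import Data.Sum using (_⊎_; inj₁; inj₂)
open import Data.Empty using (⊥-elim)
open import Relation.Nullary using (¬_; yes; no; ¬?)
open import Function using (id; _∘_)
open import Relation.Nullary.Decidable using (_×-dec_)
open import Relation.Binary.PropositionalEquality using (_≡_; _≢_; refl; sym; trans; subst; cong; cong₂)

private
  variable
    k : ℕ

x∈p─q⇒x∉q : ∀ (p q : Subset k) {x} → x ∈ p ─ q → x ∉ q
x∈p─q⇒x∉q (_ ∷ p) (outside ∷ q) (there x∈) (there x∈q) = x∈p─q⇒x∉q p q x∈ x∈q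
x∈p─q⇒x∉q (_ ∷ p) (inside ∷ q)  (there x∈) (there x∈q) = x∈p─q⇒x∉q p q x∈ x∈q

x∈p-y⇒x≢y : ∀ (p : Subset k) {x y} → x ∈ p - y → x ≢ y
x∈p-y⇒x≢y p {x} x∈ refl = x∈p─q⇒x∉q p ⁅ x ⁆ x∈ (x∈⁅x⁆ x)

x∈p-y⇒x∈p : ∀ (p : Subset k) {x y} → x ∈ p - y → x ∈ p
x∈p-y⇒x∈p p {y = y} = p─q⊆p p ⁅ y ⁆

x∈⁅y⁆∪⁅z⁆⇒x≡y⊎x≡z : ∀ {x y z : Fin k} → x ∈ ⁅ y ⁆ ∪ ⁅ z ⁆ → x ≡ y ⊎ x ≡ z
x∈⁅y⁆∪⁅z⁆⇒x≡y⊎x≡z {y = y} {z} x∈ with x∈p∪q⁻ ⁅ y ⁆ ⁅ z ⁆ x∈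
... | inj₁ x∈⁅y⁆ = inj₁ (x∈⁅y⁆⇒x≡y y x∈⁅y⁆)
... | inj₂ x∈⁅z⁆ = inj₂ (x∈⁅y⁆⇒x≡y z x∈⁅z⁆)

⁅x⁆∪⁅y⁆⊆p : ∀ {p : Subset k} {x y} → x ∈ p → y ∈ p → ⁅ x ⁆ ∪ ⁅ y ⁆ ⊆ p
⁅x⁆∪⁅y⁆⊆p x∈ y∈ z∈ with x∈⁅y⁆∪⁅z⁆⇒x≡y⊎x≡z z∈
... | inj₁ refl = x∈
... | inj₂ refl = y∈

⁅x⁆∪⁅y⁆-x⊆⁅y⁆ : ∀ (x y : Fin k) → ⁅ x ⁆ ∪ ⁅ y ⁆ - x ⊆ ⁅ y ⁆
⁅x⁆∪⁅y⁆-x⊆⁅y⁆ x y z∈ with x∈⁅y⁆∪⁅z⁆⇒x≡y⊎x≡z (x∈p-y⇒x∈p (⁅ x ⁆ ∪ ⁅ y ⁆) z∈)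
... | inj₁ refl = ⊥-elim (x∈p-y⇒x≢y (⁅ x ⁆ ∪ ⁅ y ⁆) z∈ refl)
... | inj₂ refl = x∈⁅x⁆ y

⁅x⁆∪⁅y⁆-y⊆⁅x⁆ : ∀ (x y : Fin k) → ⁅ x ⁆ ∪ ⁅ y ⁆ - y ⊆ ⁅ x ⁆
⁅x⁆∪⁅y⁆-y⊆⁅x⁆ x y z∈ with x∈⁅y⁆∪⁅z⁆⇒x≡y⊎x≡z (x∈p-y⇒x∈p (⁅ x ⁆ ∪ ⁅ y ⁆) z∈)
... | inj₁ refl = x∈⁅x⁆ x
... | inj₂ refl = ⊥-elim (x∈p-y⇒x≢y (⁅ x ⁆ ∪ ⁅ y ⁆) z∈ refl)

∣p∪q∣≤∣p∣+∣q∣ : ∀ (p q : Subset k) → ∣ p ∪ q ∣ ≤ ∣ p ∣ + ∣ q ∣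
∣p∪q∣≤∣p∣+∣q∣ [] [] = z≤n
∣p∪q∣≤∣p∣+∣q∣ (true ∷ p) (true ∷ q) = s≤s (≤-trans (∣p∪q∣≤∣p∣+∣q∣ p q) (+-monoʳ-≤ ∣ p ∣ (n≤1+n ∣ q ∣)))
∣p∪q∣≤∣p∣+∣q∣ (true ∷ p) (false ∷ q) = s≤s (∣p∪q∣≤∣p∣+∣q∣ p q)
∣p∪q∣≤∣p∣+∣q∣ (false ∷ p) (true ∷ q) = ≤-trans (s≤s (∣p∪q∣≤∣p∣+∣q∣ p q)) (≤-reflexive (sym (+-suc ∣ p ∣ ∣ q ∣)))
∣p∪q∣≤∣p∣+∣q∣ (false ∷ p) (false ∷ q) = ∣p∪q∣≤∣p∣+∣q∣ p q

∣⁅x⁆∪⁅y⁆∣≤2 : ∀ (x y : Fin k) → ∣ ⁅ x ⁆ ∪ ⁅ y ⁆ ∣ ≤ 2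
∣⁅x⁆∪⁅y⁆∣≤2 x y = ≤-trans (∣p∪q∣≤∣p∣+∣q∣ ⁅ x ⁆ ⁅ y ⁆) (≤-reflexive (cong₂ _+_ (∣⁅x⁆∣≡1 x) (∣⁅x⁆∣≡1 y)))

2≤∣⁅x⁆∪⁅y⁆∣ : ∀ {x y : Fin k} → x ≢ y → 2 ≤ ∣ ⁅ x ⁆ ∪ ⁅ y ⁆ ∣
2≤∣⁅x⁆∪⁅y⁆∣ {x = x} {y} x≢y = <-≤-trans (s≤s 1≤∣P-x∣) (x∈p⇒∣p-x∣<∣p∣ (x∈p∪q⁺ (inj₁ (x∈⁅x⁆ x))))
  where
  ⁅y⁆⊆P-x : ⁅ y ⁆ ⊆ ⁅ x ⁆ ∪ ⁅ y ⁆ - x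
  ⁅y⁆⊆P-x z∈ = x∈p∧x≢y⇒x∈p-y (x∈p∪q⁺ (inj₂ z∈)) λ { refl → x≢y (x∈⁅y⁆⇒x≡y y z∈) }

  1≤∣P-x∣ : 1 ≤ ∣ ⁅ x ⁆ ∪ ⁅ y ⁆ - x ∣
  1≤∣P-x∣ = subst (_≤ ∣ ⁅ x ⁆ ∪ ⁅ y ⁆ - x ∣) (∣⁅x⁆∣≡1 y) (p⊆q⇒∣p∣≤∣q∣ ⁅y⁆⊆P-x)

nonempty⊎∣p∣≡0 : ∀ {m} (p : Subset m) → Nonempty p ⊎ ∣ p ∣ ≡ 0
nonempty⊎∣p∣≡0 {m} p with nonempty? p
... | yes ne = inj₁ ne
... | no empty = inj₂ (trans (cong ∣_∣ (Empty-unique empty)) (∣⊥∣≡0 m))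

distinct-of-2≤ : ∀ {m} → 2 ≤ m → ∃₂ λ (x y : Fin m) → x ≢ y
distinct-of-2≤ (s≤s (s≤s _)) = zero , suc zero , λ ()

third-of-2<∣p∣ : ∀ {p : Subset k} → 2 < ∣ p ∣ → ∀ x y → ∃ λ w → w ∈ p × w ≢ x × w ≢ y
third-of-2<∣p∣ {p = p} 2<∣p∣ x y with any? (λ w → (w ∈? p) ×-dec (¬? (w ≟ x) ×-dec ¬? (w ≟ y)))
... | yes (w , w∈ , w≢x , w≢y) = w , w∈ , w≢x , w≢y
... | no ∄w = ⊥-elim (<⇒≱ 2<∣p∣ (≤-trans (p⊆q⇒∣p∣≤∣q∣ p⊆) (∣⁅x⁆∪⁅y⁆∣≤2 x y)))
  where
  p⊆ : p ⊆ ⁅ x ⁆ ∪ ⁅ y ⁆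
  p⊆ {z} z∈ with z ≟ x | z ≟ y
  ... | yes refl | _        = x∈p∪q⁺ (inj₁ (x∈⁅x⁆ z))
  ... | no _     | yes refl = x∈p∪q⁺ (inj₂ (x∈⁅x⁆ z))
  ... | no z≢x   | no z≢y   = ⊥-elim (∄w (z , z∈ , z≢x , z≢y))

module _ (G : Graph) where
  open Graph G using () renaming (_~_ to _≈_)

  ≈-sym : ∀ {x y} → x ≈ y → y ≈ x
  ≈-sym {x} {y} x≈y = trans (Graph.sym G y x) x≈y

  ≈⇒≢ : ∀ {x y} → x ≈ y → x ≢ y
  ≈⇒≢ {x} x≈x refl with trans (sym x≈x) (irrefl G x)
  ... | ()

  independent-⊆ : ∀ {S T} → T ⊆ S → Independent G S → Independent G T
  independent-⊆ T⊆S ind x y x∈ y∈ = ind x y (T⊆S x∈) (T⊆S y∈)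

  independent⇒deltaConvex : ∀ {T} → Independent G T → DeltaConvex G T
  independent⇒deltaConvex ind x y _ x∈ y∈ x≈y _ _ = ⊥-elim (ind x y x∈ y∈ x≈y)

  ⁅x⁆-deltaConvex : ∀ w → DeltaConvex G ⁅ w ⁆
  ⁅x⁆-deltaConvex w x y _ x∈ y∈ x≈y _ _ =
    ⊥-elim (≈⇒≢ x≈y (trans (x∈⁅y⁆⇒x≡y w x∈) (sym (x∈⁅y⁆⇒x≡y w y∈))))

  ∈⇒inHull : ∀ {T v} → v ∈ T → InHull G T v
  ∈⇒inHull v∈ C T⊆C _ = T⊆C v∈

  inHull-mono : ∀ {S T v} → S ⊆ T → InHull G S v → InHull G T v
  inHull-mono S⊆T v∈⟨S⟩ C T⊆C = v∈⟨S⟩ C (T⊆C ∘ S⊆T)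

  commonNeighbour⇒inHull : ∀ {T x y v} → x ∈ T → y ∈ T → x ≈ y → x ≈ v → y ≈ v → InHull G T v
  commonNeighbour⇒inHull x∈ y∈ x≈y x≈v y≈v C T⊆C convex = convex _ _ _ (T⊆C x∈) (T⊆C y∈) x≈y x≈v y≈v

  hellyDependent-byMember : ∀ {S v} → v ∈ S → InHull G (S - v) v → HellyDependent G S
  hellyDependent-byMember {v = v} v∈ v∈⟨S-v⟩ = v , λ a _ → v∈⟨S-a⟩ a
    where
    v∈⟨S-a⟩ : ∀ a → InHull G (_ - a) v
    v∈⟨S-a⟩ a with v ≟ a
    ... | yes refl = v∈⟨S-v⟩
    ... | no v≢a   = ∈⇒inHull (x∈p∧x≢y⇒x∈p-y v∈ v≢a)

  independent⇒hellyIndependent : ∀ {S} → Independent G S → Nonempty S → HellyIndependent G S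
  independent⇒hellyIndependent {S} ind (a , a∈) (v , v∈⟨S-·⟩) = x∈p-y⇒x≢y S (v∈S- v∈S) refl
    where
    v∈S- : ∀ {b} → b ∈ S → v ∈ S - b
    v∈S- {b} b∈ = v∈⟨S-·⟩ b b∈ (S - b) id (independent⇒deltaConvex (independent-⊆ (x∈p-y⇒x∈p S) ind))

    v∈S : v ∈ S
    v∈S = x∈p-y⇒x∈p S (v∈S- a∈)

  distinct⇒pair-hellyIndependent : ∀ {u w} → u ≢ w → HellyIndependent G (⁅ u ⁆ ∪ ⁅ w ⁆)
  distinct⇒pair-hellyIndependent {u} {w} u≢w (v , v∈⟨P-·⟩) =
    u≢w (trans (sym (v≡ w∈P u (⁅x⁆∪⁅y⁆-y⊆⁅x⁆ u w))) (v≡ u∈P w (⁅x⁆∪⁅y⁆-x⊆⁅y⁆ u w)))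
    where
    P = ⁅ u ⁆ ∪ ⁅ w ⁆
    u∈P : u ∈ P
    u∈P = x∈p∪q⁺ (inj₁ (x∈⁅x⁆ u))
    w∈P : w ∈ P
    w∈P = x∈p∪q⁺ (inj₂ (x∈⁅x⁆ w))
    v≡ : ∀ {a} → a ∈ P → ∀ b → P - a ⊆ ⁅ b ⁆ → v ≡ b
    v≡ {a} a∈ b P-a⊆ = x∈⁅y⁆⇒x≡y b (v∈⟨P-·⟩ a a∈ ⁅ b ⁆ P-a⊆ (⁅x⁆-deltaConvex b))

  triangle⇒hellyDependent : ∀ {S x y z} → x ∈ S → y ∈ S → z ∈ S →
                            x ≈ y → y ≈ z → x ≈ z → HellyDependent G S
  triangle⇒hellyDependent x∈ y∈ z∈ x≈y y≈z x≈z =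
    hellyDependent-byMember x∈
      (commonNeighbour⇒inHull (x∈p∧x≢y⇒x∈p-y y∈ (≈⇒≢ x≈y ∘ sym)) (x∈p∧x≢y⇒x∈p-y z∈ (≈⇒≢ x≈z ∘ sym))
                              y≈z (≈-sym x≈y) (≈-sym x≈z))

  edge-or-independent : ∀ S → (∃₂ λ x y → x ∈ S × y ∈ S × x ≈ y) ⊎ Independent G S
  edge-or-independent S with any? (λ x → any? (λ y → (x ∈? S) ×-dec (y ∈? S) ×-dec (adj G x y Bool.≟ true)))
  ... | yes edge = inj₁ edge
  ... | no ∄edge = inj₂ λ x y x∈ y∈ x≈y → ∄edge (x , y , x∈ , y∈ , x≈y)

  hellyIndependent⇒∣∣≤ : ∀ {h S} → IsHellyNumber G h → HellyIndependent G S → ∣ S ∣ ≤ h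
  hellyIndependent⇒∣∣≤ {S = S} (dependent , _) independent = ≮⇒≥ (independent ∘ dependent S)

  independenceNumber≤hellyNumber : ∀ h a → IsHellyNumber G h → IsIndependenceNumber G a → a ≤ h
  independenceNumber≤hellyNumber h a H ((S , ind , refl) , _) with nonempty⊎∣p∣≡0 S
  ... | inj₁ nonempty = hellyIndependent⇒∣∣≤ H (independent⇒hellyIndependent ind nonempty)
  ... | inj₂ ∣S∣≡0    = subst (_≤ h) (sym ∣S∣≡0) z≤n

  2≤hellyNumber : ∀ {h} → 2 ≤ n G → IsHellyNumber G h → 2 ≤ h
  2≤hellyNumber 2≤n H with distinct-of-2≤ 2≤n
  ... | u , w , u≢w = ≤-trans (2≤∣⁅x⁆∪⁅y⁆∣ u≢w) (hellyIndependent⇒∣∣≤ H (distinct⇒pair-hellyIndependent u≢w))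

  edgeHullSets⇒hellyDependent : (∀ u v → u ≈ v → HullSet₂ G u v) → ∀ {a} → IsIndependenceNumber G a →
                                ∀ S → 2 ⊔ a < ∣ S ∣ → HellyDependent G S
  edgeHullSets⇒hellyDependent hull {a} (_ , maximal) S 2⊔a<∣S∣ with edge-or-independent S
  ... | inj₂ ind = ⊥-elim (<⇒≱ (m⊔n<o⇒n<o 2 a 2⊔a<∣S∣) (maximal S ind))
  ... | inj₁ (x , y , x∈ , y∈ , x≈y) with third-of-2<∣p∣ (m⊔n<o⇒m<o 2 a 2⊔a<∣S∣) x y
  ...   | w , w∈ , w≢x , w≢y =
    hellyDependent-byMember w∈
      (inHull-mono (⁅x⁆∪⁅y⁆⊆p (x∈p∧x≢y⇒x∈p-y x∈ (w≢x ∘ sym)) (x∈p∧x≢y⇒x∈p-y y∈ (w≢y ∘ sym)))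
                   (hull x y x≈y w))

lemma2 : (CG : ConnectedGraph) →
    let G = graph CG in
    (∀ (h a : ℕ) → IsHellyNumber G h → IsIndependenceNumber G a → a ≤ h)
    × (∀ (S : Subset (n G)) → HellyIndependent G S →
         ∀ x y z → x ∈ S → y ∈ S → z ∈ S →
         ¬ (_~_ G x y × _~_ G y z × _~_ G x z))
    × (2 ≤ n G → (∀ u v → _~_ G u v → HullSet₂ G u v) →
         ∀ (h a : ℕ) → IsHellyNumber G h → IsIndependenceNumber G a → h ≡ 2 ⊔ a)
lemma2 CG = independenceNumber≤hellyNumber G , triangle-free , hellyNumber≡2⊔a
  where
  G = graph CG

  triangle-free : ∀ S → HellyIndependent G S → ∀ x y z → x ∈ S → y ∈ S → z ∈ S →
                  ¬ (_~_ G x y × _~_ G y z × _~_ G x z)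
  triangle-free S independent x y z x∈ y∈ z∈ (x~y , y~z , x~z) =
    independent (triangle⇒hellyDependent G x∈ y∈ z∈ x~y y~z x~z)

  hellyNumber≡2⊔a : 2 ≤ n G → (∀ u v → _~_ G u v → HullSet₂ G u v) →
                    ∀ h a → IsHellyNumber G h → IsIndependenceNumber G a → h ≡ 2 ⊔ a
  hellyNumber≡2⊔a 2≤n hull h a H A =
    ≤-antisym (proj₂ H (2 ⊔ a) (edgeHullSets⇒hellyDependent G hull A))
              (⊔-lub (2≤hellyNumber G 2≤n H) (independenceNumber≤hellyNumber G h a H A))
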